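{- Let $A\subseteq\mathbb{N}$ be a sum-dominant set with $|A|=6$. Then $A-A$ contains at most $8$ distinct positive elements.
   Context: For a finite set $A\subseteq\mathbb{N}$, $A+A=\{a+a' : a,a'\in A\}$ and $A-A=\{a-a' : a,a'\in A\}$. The set $A$ is called sum-dominant if $|A+A|>|A-A|$. -}

module Defs where

open import Data.Nat as ℕ using (ℕ)
open import Data.Integer as ℤ using (ℤ; _⊖_; +_; +[1+_])
open import Data.List using (List; length; cartesianProductWith; deduplicate; filter)
open import Data.Nat.Properties as ℕP using ()
open import Data.Integer.Properties as ℤP using ()
open import Relation.Unary using (Pred)

-- A finite set A ⊆ ℕ is represented by a duplicate-free list of its elements.

sumList : List ℕ → List ℕ
sumList A = cartesianProductWith ℕ._+_ A A

diffList : List ℕ → List ℤ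
diffList A = cartesianProductWith _⊖_ A A

card+ : List ℕ → ℕ
card+ A = length (deduplicate ℕP._≟_ (sumList A))

card- : List ℕ → ℕ
card- A = length (deduplicate ℤP._≟_ (diffList A))

SumDominant : List ℕ → Set
SumDominant A = card- A ℕ.< card+ A

cardPosDiff : List ℕ → ℕ
cardPosDiff A = length (filter (λ d → + 0 ℤP.<? d) (deduplicate ℤP._≟_ (diffList A)))

module Submission where

-- Let A = {a₀ < a₁ < … < a₅} be sum-dominant and suppose, for a contradiction,
-- that A − A has p ≥ 9 distinct positive elements.
--   * Since A − A is symmetric and contains 0, |A − A| ≥ 2p + 1 ≥ 19, so
--     |A + A| ≥ 20.  The 21 sums aᵢ + aⱼ (i ≤ j) therefore contain at most one
--     coincidence, i.e. at most one pair of index pairs with equal sums.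
--   * Every coincidence aⱼ − aᵢ = a_l − a_k among the 15 differences (i < j,
--     k < l) yields the sum coincidence aⱼ + a_k = aᵢ + a_l, and each sum
--     coincidence arises in this way from at most two difference coincidences
--     (a finite check over the index pairs).  Hence the differences contain at
--     most two coincidences, so at least 13 distinct positive values, and
--     |A − A| ≥ 27 > 21 ≥ |A + A|, contradicting sum-dominance.

open import Defs
open import Data.Nat as ℕ using (ℕ; suc; _+_; _*_; _∸_; _≤_; _<_; z≤n; s≤s; _≤ᵇ_)
open import Data.Nat.Properties
open import Data.Nat.ListAction using (sum)
open import Algebra.Properties.CommutativeSemigroup +-commutativeSemigroup using (interchange)
open import Data.Nat.ListAction.Properties using (sum-++)
open import Data.Integer as ℤ using (ℤ; _⊖_)
import Data.Integer.Properties as ℤP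
open import Data.Bool using (true; false; if_then_else_)
open import Data.Fin as Fin using (Fin; toℕ)
import Data.Fin.Properties as FinP
open import Data.List using (List; []; _∷_; length; map; _++_; filter; deduplicate; lookup; allFin)
open import Data.List.Properties using (length-++; length-map; map-++; map-cong)
open import Data.List.Membership.Propositional using (_∈_)
open import Data.List.Membership.Propositional.Properties
  using (∈-∃++; ∈-++⁻; ∈-++⁺ˡ; ∈-++⁺ʳ; ∈-map⁺; ∈-map⁻; ∈-lookup; ∈-allFin; ∈-filter⁻;
         ∈-deduplicate⁺; ∈-deduplicate⁻; ∈-cartesianProductWith⁺; ∈-cartesianProductWith⁻)
open import Data.List.Relation.Unary.Any using (here; there; index)
open import Data.List.Relation.Unary.Any.Properties using (lookup-index)
open import Data.List.Relation.Unary.All as All using (All; []; _∷_; all?)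
import Data.List.Relation.Unary.All.Properties as AllP
open import Data.List.Relation.Unary.AllPairs using ([]; _∷_; allPairs?)
open import Data.List.Relation.Unary.Linked as Linked using (Linked; []; [-]; _∷_)
open import Data.List.Relation.Unary.Unique.Propositional using (Unique)
import Data.List.Relation.Unary.Unique.Propositional.Properties as UniqueP
import Data.List.Relation.Unary.Unique.DecPropositional.Properties as UniqueDecP
open import Data.List.Sort ≤-decTotalOrder using (sort; sort-↭; sort-↗)
open import Data.List.Relation.Binary.Permutation.Propositional using (↭-sym; ↭⇒↭ₛ)
open import Data.List.Relation.Binary.Permutation.Propositional.Properties using (∈-resp-↭; ↭-length)
import Data.List.Relation.Binary.Permutation.Setoid.Properties as PermutationSetoidP
open import Data.Product using (_×_; _,_; proj₁; proj₂; ∃)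
open import Data.Product.Properties using (≡-dec)
open import Data.Sum using (inj₁; inj₂)
open import Data.Empty using (⊥; ⊥-elim)
open import Relation.Nullary using (Dec; yes; no; ¬?)
open import Relation.Nullary.Decidable using (toWitness)
open import Relation.Binary.Definitions using (DecidableEquality; Transitive)
open import Relation.Binary.PropositionalEquality

private
  variable
    B : Set

sum-map-+ : (f g : B → ℕ) (xs : List B) →
            sum (map (λ x → f x + g x) xs) ≡ sum (map f xs) + sum (map g xs)
sum-map-+ f g [] = refl
sum-map-+ f g (x ∷ xs) = begin
  f x + g x + sum (map (λ x → f x + g x) xs)     ≡⟨ cong (f x + g x +_) (sum-map-+ f g xs) ⟩
  f x + g x + (sum (map f xs) + sum (map g xs)) ≡⟨ interchange (f x) (g x) _ _ ⟩
  f x + sum (map f xs) + (g x + sum (map g xs)) ∎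
  where open ≡-Reasoning

sum-map-*ˡ : (k : ℕ) (f : B → ℕ) (xs : List B) → sum (map (λ x → k * f x) xs) ≡ k * sum (map f xs)
sum-map-*ˡ k f [] = sym (*-zeroʳ k)
sum-map-*ˡ k f (x ∷ xs) = trans (cong (k * f x +_) (sum-map-*ˡ k f xs)) (sym (*-distribˡ-+ k (f x) _))

sum-map-mono : (f g : B → ℕ) {xs : List B} → All (λ x → f x ≤ g x) xs → sum (map f xs) ≤ sum (map g xs)
sum-map-mono f g [] = z≤n
sum-map-mono f g (f≤g ∷ fs≤gs) = +-mono-≤ f≤g (sum-map-mono f g fs≤gs)

pairsOf : List B → List (B × B)
pairsOf [] = []
pairsOf (x ∷ xs) = map (x ,_) xs ++ pairsOf xs

pairsWithRepetitionOf : List B → List (B × B)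
pairsWithRepetitionOf [] = []
pairsWithRepetitionOf (x ∷ xs) = map (x ,_) (x ∷ xs) ++ pairsWithRepetitionOf xs

pairsOf-All : {P : B → Set} {xs : List B} → All P xs →
              All (λ pq → P (proj₁ pq) × P (proj₂ pq)) (pairsOf xs)
pairsOf-All [] = []
pairsOf-All {P = P} (px ∷ pxs) = AllP.++⁺ (withHead pxs) (pairsOf-All pxs)
  where
  withHead : ∀ {ys} → All P ys → All (λ pq → P (proj₁ pq) × P (proj₂ pq)) (map (_ ,_) ys)
  withHead [] = []
  withHead (py ∷ pys) = (px , py) ∷ withHead pys

unique-length-≤ : {xs ys : List B} → Unique xs → (∀ {z} → z ∈ xs → z ∈ ys) → length xs ≤ length ys
unique-length-≤ {xs = []} _ _ = z≤n
unique-length-≤ {xs = x ∷ xs} {ys} (x∉xs ∷ uxs) xs⊆ys with ∈-∃++ (xs⊆ys (here refl))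
... | ys₁ , ys₂ , refl = begin
  suc (length xs)                 ≤⟨ s≤s (unique-length-≤ uxs xs⊆ys₁++ys₂) ⟩
  suc (length (ys₁ ++ ys₂))       ≡⟨ cong suc (length-++ ys₁) ⟩
  suc (length ys₁ + length ys₂)   ≡⟨ +-suc (length ys₁) (length ys₂) ⟨
  length ys₁ + length (x ∷ ys₂)   ≡⟨ length-++ ys₁ ⟨
  length (ys₁ ++ x ∷ ys₂)         ∎
  where
  open ≤-Reasoning
  xs⊆ys₁++ys₂ : ∀ {z} → z ∈ xs → z ∈ ys₁ ++ ys₂
  xs⊆ys₁++ys₂ z∈xs with ∈-++⁻ ys₁ (xs⊆ys (there z∈xs))
  ... | inj₁ z∈ys₁ = ∈-++⁺ˡ z∈ys₁
  ... | inj₂ (here refl) = ⊥-elim (All.lookup x∉xs z∈xs refl)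
  ... | inj₂ (there z∈ys₂) = ∈-++⁺ʳ ys₁ z∈ys₂

lookup-increasing : {R : B → B → Set} → Transitive R → {xs : List B} → Linked R xs →
                    ∀ {i j} → i Fin.< j → R (lookup xs i) (lookup xs j)
lookup-increasing tr {_ ∷ _} l {Fin.zero} {Fin.suc j} _ = Linked.lookup tr (Linked.tail l) (Linked.head′ l) j
lookup-increasing tr {_ ∷ _} l {Fin.suc i} {Fin.suc j} (s≤s i<j) = lookup-increasing tr (Linked.tail l) i<j

module Counting {X : Set} (_≟_ : DecidableEquality X) where
  open import Data.List.Membership.DecPropositional _≟_ using (_∈?_)

  δ : X → X → ℕ
  δ x y with x ≟ y
  ... | yes _ = 1
  ... | no _ = 0

  δ-refl : ∀ x → δ x x ≡ 1
  δ-refl x with x ≟ x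
  ... | yes _ = refl
  ... | no x≢x = ⊥-elim (x≢x refl)

  δ-≢ : ∀ {x y} → x ≢ y → δ x y ≡ 0
  δ-≢ {x} {y} x≢y with x ≟ y
  ... | yes x≡y = ⊥-elim (x≢y x≡y)
  ... | no _ = refl

  δ-sym : ∀ x y → δ x y ≡ δ y x
  δ-sym x y with x ≟ y
  ... | yes refl = sym (δ-refl x)
  ... | no x≢y = sym (δ-≢ (λ y≡x → x≢y (sym y≡x)))

  δ-≤ : ∀ x y {k} → (x ≡ y → 1 ≤ k) → δ x y ≤ k
  δ-≤ x y x≡y⇒1≤k with x ≟ y
  ... | yes x≡y = x≡y⇒1≤k x≡y
  ... | no _ = z≤n

  count : X → List X → ℕ
  count x xs = sum (map (δ x) xs)

  count-∈ : ∀ {x xs} → x ∈ xs → 1 ≤ count x xs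
  count-∈ {x} {y ∷ xs} (here refl) rewrite δ-refl x = s≤s z≤n
  count-∈ {x} {y ∷ xs} (there x∈xs) = ≤-trans (count-∈ x∈xs) (m≤n+m _ (δ x y))

  count-∉ : ∀ {x xs} → All (x ≢_) xs → count x xs ≡ 0
  count-∉ [] = refl
  count-∉ (x≢y ∷ x∉xs) rewrite δ-≢ x≢y = count-∉ x∉xs

  count-unique : ∀ x {xs} → Unique xs → count x xs ≤ 1
  count-unique x [] = z≤n
  count-unique x {y ∷ xs} (y∉xs ∷ uxs) with x ≟ y
  ... | yes refl rewrite count-∉ y∉xs = ≤-refl
  ... | no _ = count-unique x uxs

  collisions : List X → ℕ
  collisions [] = 0
  collisions (x ∷ xs) = count x xs + collisions xs

  collisions-unique : ∀ {xs} → Unique xs → collisions xs ≡ 0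
  collisions-unique [] = refl
  collisions-unique (x∉xs ∷ uxs) rewrite count-∉ x∉xs = collisions-unique uxs

  collisions-map : {B : Set} (f : B → X) (xs : List B) →
                   collisions (map f xs) ≡ sum (map (λ pq → δ (f (proj₁ pq)) (f (proj₂ pq))) (pairsOf xs))
  collisions-map f [] = refl
  collisions-map {B} f (x ∷ xs) = begin
    count (f x) (map f xs) + collisions (map f xs)    ≡⟨ cong₂ _+_ (headPairs xs) (collisions-map f xs) ⟩
    sum (map g (map (x ,_) xs)) + sum (map g (pairsOf xs)) ≡⟨ sum-++ (map g (map (x ,_) xs)) _ ⟨
    sum (map g (map (x ,_) xs) ++ map g (pairsOf xs))  ≡⟨ cong sum (map-++ g (map (x ,_) xs) (pairsOf xs)) ⟨
    sum (map g (map (x ,_) xs ++ pairsOf xs))          ∎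
    where
    open ≡-Reasoning
    g : B × B → ℕ
    g pq = δ (f (proj₁ pq)) (f (proj₂ pq))
    headPairs : ∀ ys → count (f x) (map f ys) ≡ sum (map g (map (x ,_) ys))
    headPairs [] = refl
    headPairs (y ∷ ys) = cong (δ (f x) (f y) +_) (headPairs ys)

  nub : List X → List X
  nub [] = []
  nub (x ∷ xs) with x ∈? xs
  ... | yes _ = nub xs
  ... | no _ = x ∷ nub xs

  repeats : List X → ℕ
  repeats [] = 0
  repeats (x ∷ xs) with x ∈? xs
  ... | yes _ = suc (repeats xs)
  ... | no _ = repeats xs

  distinct : List X → ℕ
  distinct xs = length (nub xs)

  distinct+repeats : ∀ xs → distinct xs + repeats xs ≡ length xs
  distinct+repeats [] = refl
  distinct+repeats (x ∷ xs) with x ∈? xs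
  ... | yes _ = trans (+-suc (distinct xs) (repeats xs)) (cong suc (distinct+repeats xs))
  ... | no _ = cong suc (distinct+repeats xs)

  ∈-nub⁻ : ∀ {z} xs → z ∈ nub xs → z ∈ xs
  ∈-nub⁻ (x ∷ xs) z∈ with x ∈? xs
  ... | yes _ = there (∈-nub⁻ xs z∈)
  ∈-nub⁻ (x ∷ xs) (here z≡x) | no _ = here z≡x
  ∈-nub⁻ (x ∷ xs) (there z∈) | no _ = there (∈-nub⁻ xs z∈)

  ∈-nub⁺ : ∀ {z} xs → z ∈ xs → z ∈ nub xs
  ∈-nub⁺ (x ∷ xs) z∈ with x ∈? xs
  ∈-nub⁺ (x ∷ xs) (here refl) | yes x∈xs = ∈-nub⁺ xs x∈xs
  ∈-nub⁺ (x ∷ xs) (there z∈) | yes _ = ∈-nub⁺ xs z∈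
  ∈-nub⁺ (x ∷ xs) (here z≡x) | no _ = here z≡x
  ∈-nub⁺ (x ∷ xs) (there z∈) | no _ = there (∈-nub⁺ xs z∈)

  nub-unique : ∀ xs → Unique (nub xs)
  nub-unique [] = []
  nub-unique (x ∷ xs) with x ∈? xs
  ... | yes _ = nub-unique xs
  ... | no x∉xs = AllP.¬Any⇒All¬ (nub xs) (λ x∈ → x∉xs (∈-nub⁻ xs x∈)) ∷ nub-unique xs

  distinct≤length : ∀ xs → distinct xs ≤ length xs
  distinct≤length xs = ≤-trans (m≤m+n (distinct xs) (repeats xs)) (≤-reflexive (distinct+repeats xs))

  repeats-0⇒unique : ∀ xs → repeats xs ≡ 0 → Unique xs
  repeats-0⇒unique [] _ = []
  repeats-0⇒unique (x ∷ xs) r≡0 with x ∈? xs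
  ... | no x∉xs = AllP.¬Any⇒All¬ xs x∉xs ∷ repeats-0⇒unique xs r≡0

  -- Every dropped entry has an equal later entry, so it is part of a coincidence.
  repeats≤collisions : ∀ xs → repeats xs ≤ collisions xs
  repeats≤collisions [] = z≤n
  repeats≤collisions (x ∷ xs) with x ∈? xs
  ... | yes x∈xs = +-mono-≤ (count-∈ x∈xs) (repeats≤collisions xs)
  ... | no _ = ≤-trans (repeats≤collisions xs) (m≤n+m _ _)

  repeats≤1⇒collisions≤1 : ∀ xs → repeats xs ≤ 1 → collisions xs ≤ 1
  repeats≤1⇒collisions≤1 [] _ = z≤n
  repeats≤1⇒collisions≤1 (x ∷ xs) r≤1 with x ∈? xs
  ... | yes _ = begin
    count x xs + collisions xs ≡⟨ cong (count x xs +_) (collisions-unique uxs) ⟩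
    count x xs + 0             ≡⟨ +-identityʳ _ ⟩
    count x xs                 ≤⟨ count-unique x uxs ⟩
    1                          ∎
    where
    open ≤-Reasoning
    uxs : Unique xs
    uxs = repeats-0⇒unique xs (n≤0⇒n≡0 (≤-pred r≤1))
  ... | no x∉xs rewrite count-∉ (AllP.¬Any⇒All¬ xs x∉xs) = repeats≤1⇒collisions≤1 xs r≤1

  module DoubleCounting (ψ : B → X) where

    fibre : List B → X → ℕ
    fibre Ts σ = sum (map (λ τ → δ (ψ τ) σ) Ts)

    sum-select : (u : X → ℕ) {x : X} {M : List X} → Unique M → x ∈ M →
                 sum (map (λ σ → δ x σ * u σ) M) ≡ u x
    sum-select u {M = y ∷ M} (y∉M ∷ _) (here refl) = begin
      δ y y * u y + sum (map (λ σ → δ y σ * u σ) M) ≡⟨ cong₂ (λ e r → e * u y + r) (δ-refl y) (othersVanish M y∉M) ⟩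
      1 * u y + 0                                   ≡⟨ trans (+-identityʳ _) (*-identityˡ (u y)) ⟩
      u y                                           ∎
      where
      open ≡-Reasoning
      othersVanish : ∀ N → All (y ≢_) N → sum (map (λ σ → δ y σ * u σ) N) ≡ 0
      othersVanish [] _ = refl
      othersVanish (z ∷ N) (y≢z ∷ y∉N) rewrite δ-≢ y≢z = othersVanish N y∉N
    sum-select u {x} {y ∷ M} (y∉M ∷ uM) (there x∈M)
      rewrite δ-≢ {x} {y} (λ x≡y → All.lookup y∉M x∈M (sym x≡y)) = sum-select u uM x∈M

    sum-fibres : (u : X → ℕ) {M : List X} → Unique M → (Ts : List B) → All (λ τ → ψ τ ∈ M) Ts →
                 sum (map (λ τ → u (ψ τ)) Ts) ≡ sum (map (λ σ → fibre Ts σ * u σ) M)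
    sum-fibres u {M} uM [] [] = sym (sum-map-*ˡ 0 u M)
    sum-fibres u {M} uM (τ ∷ Ts) (ψτ∈M ∷ ψTs⊆M) = begin
      u (ψ τ) + sum (map (λ τ → u (ψ τ)) Ts)
        ≡⟨ cong₂ _+_ (sym (sum-select u uM ψτ∈M)) (sum-fibres u uM Ts ψTs⊆M) ⟩
      sum (map (λ σ → δ (ψ τ) σ * u σ) M) + sum (map (λ σ → fibre Ts σ * u σ) M)
        ≡⟨ sum-map-+ (λ σ → δ (ψ τ) σ * u σ) (λ σ → fibre Ts σ * u σ) M ⟨
      sum (map (λ σ → δ (ψ τ) σ * u σ + fibre Ts σ * u σ) M)
        ≡⟨ cong sum (map-cong (λ σ → sym (*-distribʳ-+ (u σ) (δ (ψ τ) σ) _)) M) ⟩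
      sum (map (λ σ → fibre (τ ∷ Ts) σ * u σ) M) ∎
      where open ≡-Reasoning

    sum-fibres-≤ : (u : X → ℕ) (k : ℕ) {M : List X} → Unique M → (Ts : List B) →
                   All (λ τ → ψ τ ∈ M) Ts → All (λ σ → fibre Ts σ ≤ k) M →
                   sum (map (λ τ → u (ψ τ)) Ts) ≤ k * sum (map u M)
    sum-fibres-≤ u k {M} uM Ts ψTs⊆M fibres≤k = begin
      sum (map (λ τ → u (ψ τ)) Ts)          ≡⟨ sum-fibres u uM Ts ψTs⊆M ⟩
      sum (map (λ σ → fibre Ts σ * u σ) M)  ≤⟨ sum-map-mono _ _ (All.map (*-monoˡ-≤ _) fibres≤k) ⟩
      sum (map (λ σ → k * u σ) M)           ≡⟨ sum-map-*ˡ k u M ⟩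
      k * sum (map u M)                     ∎
      where open ≤-Reasoning

Index : Set
Index = Fin 6

Pair : Set
Pair = Index × Index

_≟ᴾ_ : DecidableEquality Pair
_≟ᴾ_ = ≡-dec FinP._≟_ FinP._≟_

_≟ᴾᴾ_ : DecidableEquality (Pair × Pair)
_≟ᴾᴾ_ = ≡-dec _≟ᴾ_ _≟ᴾ_

-- (i , j) with i ≤ j: the 21 index pairs of the sums aᵢ + aⱼ.
SumPairs : List Pair
SumPairs = pairsWithRepetitionOf (allFin 6)

-- (i , j) with i < j: the 15 index pairs of the positive differences aⱼ − aᵢ.
DiffPairs : List Pair
DiffPairs = pairsOf (allFin 6)

order : Index → Index → Pair
order i j = if toℕ i ≤ᵇ toℕ j then (i , j) else (j , i)

-- The pair of pairs {P , Q} written in the order in which it is listed in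
-- pairsOf SumPairs, i.e. lexicographically.
rank : Pair → ℕ
rank (i , j) = 6 * toℕ i + toℕ j

orderPairs : Pair → Pair → Pair × Pair
orderPairs P Q = if rank P ≤ᵇ rank Q then (P , Q) else (Q , P)

-- A coincidence aⱼ − aᵢ = a_l − a_k of differences yields the coincidence
-- aⱼ + a_k = aᵢ + a_l of sums; this map records the index pairs involved.
toSumCoincidence : Pair × Pair → Pair × Pair
toSumCoincidence ((i , j) , (k , l)) = orderPairs (order j k) (order i l)

open Counting _≟ᴾᴾ_ using (module DoubleCounting)
open DoubleCounting toSumCoincidence using (fibre; sum-fibres-≤)

order∈SumPairs : ∀ i j → order i j ∈ SumPairs
order∈SumPairs i j = All.lookup (All.lookup orderedAll (∈-allFin i)) (∈-allFin j)
  where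
  open import Data.List.Membership.DecPropositional _≟ᴾ_ using (_∈?_)
  orderedAll : All (λ i → All (λ j → order i j ∈ SumPairs) (allFin 6)) (allFin 6)
  orderedAll = toWitness {a? = all? (λ i → all? (λ j → order i j ∈? SumPairs) (allFin 6)) (allFin 6)} _

DiffPairs-increasing : All (λ P → proj₁ P Fin.< proj₂ P) DiffPairs
DiffPairs-increasing = toWitness {a? = all? (λ P → proj₁ P Fin.<? proj₂ P) DiffPairs} _

pairsOfSumPairs-unique : Unique (pairsOf SumPairs)
pairsOfSumPairs-unique = toWitness {a? = allPairs? (λ σ σ′ → ¬? (σ ≟ᴾᴾ σ′)) (pairsOf SumPairs)} _

toSumCoincidence-lands : All (λ τ → toSumCoincidence τ ∈ pairsOf SumPairs) (pairsOf DiffPairs)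
toSumCoincidence-lands = toWitness {a? = all? (λ τ → toSumCoincidence τ ∈? pairsOf SumPairs) (pairsOf DiffPairs)} _
  where open import Data.List.Membership.DecPropositional _≟ᴾᴾ_ using (_∈?_)

toSumCoincidence-fibres≤2 : All (λ σ → fibre (pairsOf DiffPairs) σ ≤ 2) (pairsOf SumPairs)
toSumCoincidence-fibres≤2 = toWitness {a? = all? (λ σ → fibre (pairsOf DiffPairs) σ ℕ.≤? 2) (pairsOf SumPairs)} _

equal-differences⇒equal-sums : ∀ {p q r t} → p ≤ q → r ≤ t → q ∸ p ≡ t ∸ r → q + r ≡ t + p
equal-differences⇒equal-sums {p} {q} {r} {t} p≤q r≤t eq = begin
  q + r             ≡⟨ cong (_+ r) (m∸n+n≡m p≤q) ⟨
  q ∸ p + p + r     ≡⟨ +-assoc (q ∸ p) p r ⟩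
  q ∸ p + (p + r)   ≡⟨ cong₂ _+_ eq (+-comm p r) ⟩
  t ∸ r + (r + p)   ≡⟨ +-assoc (t ∸ r) r p ⟨
  t ∸ r + r + p     ≡⟨ cong (_+ p) (m∸n+n≡m r≤t) ⟩
  t + p             ∎
  where open ≡-Reasoning

module IncreasingSix (a : Index → ℕ) (increasing : ∀ {i j} → i Fin.< j → a i < a j) where
  open Counting ℕ._≟_

  sumOf : Pair → ℕ
  sumOf (i , j) = a i + a j

  diffOf : Pair → ℕ
  diffOf (i , j) = a j ∸ a i

  sumCoincides : Pair × Pair → ℕ
  sumCoincides σ = δ (sumOf (proj₁ σ)) (sumOf (proj₂ σ))

  diffCoincides : Pair × Pair → ℕ
  diffCoincides τ = δ (diffOf (proj₁ τ)) (diffOf (proj₂ τ))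

  sumOf-order : ∀ i j → sumOf (order i j) ≡ a i + a j
  sumOf-order i j with toℕ i ≤ᵇ toℕ j
  ... | true = refl
  ... | false = +-comm (a j) (a i)

  sumCoincides-orderPairs : ∀ P Q → sumCoincides (orderPairs P Q) ≡ δ (sumOf P) (sumOf Q)
  sumCoincides-orderPairs P Q with rank P ≤ᵇ rank Q
  ... | true = refl
  ... | false = δ-sym (sumOf Q) (sumOf P)

  diffCoincides≤sumCoincides : ∀ {i j k l} → i Fin.< j → k Fin.< l →
    diffCoincides ((i , j) , (k , l)) ≤ sumCoincides (toSumCoincidence ((i , j) , (k , l)))
  diffCoincides≤sumCoincides {i} {j} {k} {l} i<j k<l = δ-≤ (a j ∸ a i) (a l ∸ a k) λ eq → ≤-reflexive (sym (begin
    sumCoincides (orderPairs (order j k) (order i l)) ≡⟨ sumCoincides-orderPairs (order j k) (order i l) ⟩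
    δ (sumOf (order j k)) (sumOf (order i l))         ≡⟨ cong₂ δ (sumOf-order j k) (sumOf-order i l) ⟩
    δ (a j + a k) (a i + a l)                         ≡⟨ cong (δ (a j + a k)) (+-comm (a i) (a l)) ⟩
    δ (a j + a k) (a l + a i)                         ≡⟨ cong (δ (a j + a k)) (crossSums eq) ⟨
    δ (a j + a k) (a j + a k)                         ≡⟨ δ-refl (a j + a k) ⟩
    1                                                 ∎))
    where
    open ≡-Reasoning
    crossSums : a j ∸ a i ≡ a l ∸ a k → a j + a k ≡ a l + a i
    crossSums = equal-differences⇒equal-sums (<⇒≤ (increasing i<j)) (<⇒≤ (increasing k<l))

  diffCollisions≤2*sumCollisions : collisions (map diffOf DiffPairs) ≤ 2 * collisions (map sumOf SumPairs)
  diffCollisions≤2*sumCollisions = begin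
    collisions (map diffOf DiffPairs)                         ≡⟨ collisions-map diffOf DiffPairs ⟩
    sum (map diffCoincides (pairsOf DiffPairs))               ≤⟨ sum-map-mono _ _ detected ⟩
    sum (map (λ τ → sumCoincides (toSumCoincidence τ)) (pairsOf DiffPairs))
      ≤⟨ sum-fibres-≤ sumCoincides 2 pairsOfSumPairs-unique (pairsOf DiffPairs) toSumCoincidence-lands toSumCoincidence-fibres≤2 ⟩
    2 * sum (map sumCoincides (pairsOf SumPairs))             ≡⟨ cong (2 *_) (collisions-map sumOf SumPairs) ⟨
    2 * collisions (map sumOf SumPairs)                       ∎
    where
    open ≤-Reasoning
    detected : All (λ τ → diffCoincides τ ≤ sumCoincides (toSumCoincidence τ)) (pairsOf DiffPairs)
    detected = All.map (λ { {(_ , _) , (_ , _)} (i<j , k<l) → diffCoincides≤sumCoincides i<j k<l })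
                       (pairsOf-All DiffPairs-increasing)

  distinctSums≥20⇒distinctDiffs≥13 : 20 ≤ distinct (map sumOf SumPairs) → 13 ≤ distinct (map diffOf DiffPairs)
  distinctSums≥20⇒distinctDiffs≥13 sums≥20 = +-cancelʳ-≤ 2 13 _ (begin
    15                                                              ≡⟨ distinct+repeats (map diffOf DiffPairs) ⟨
    distinct (map diffOf DiffPairs) + repeats (map diffOf DiffPairs) ≤⟨ +-monoʳ-≤ _ diffRepeats≤2 ⟩
    distinct (map diffOf DiffPairs) + 2                              ∎)
    where
    open ≤-Reasoning
    sumRepeats≤1 : repeats (map sumOf SumPairs) ≤ 1
    sumRepeats≤1 = +-cancelˡ-≤ 20 _ 1 (begin
      20 + repeats (map sumOf SumPairs)                               ≤⟨ +-monoˡ-≤ _ sums≥20 ⟩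
      distinct (map sumOf SumPairs) + repeats (map sumOf SumPairs)    ≡⟨ distinct+repeats (map sumOf SumPairs) ⟩
      21                                                              ∎)
    diffRepeats≤2 : repeats (map diffOf DiffPairs) ≤ 2
    diffRepeats≤2 = begin
      repeats (map diffOf DiffPairs)        ≤⟨ repeats≤collisions (map diffOf DiffPairs) ⟩
      collisions (map diffOf DiffPairs)     ≤⟨ diffCollisions≤2*sumCollisions ⟩
      2 * collisions (map sumOf SumPairs)   ≤⟨ *-monoʳ-≤ 2 (repeats≤1⇒collisions≤1 (map sumOf SumPairs) sumRepeats≤1) ⟩
      2                                     ∎

diffList-neg : ∀ A {u} → u ∈ diffList A → ℤ.- u ∈ diffList A
diffList-neg A u∈ with ∈-cartesianProductWith⁻ _⊖_ A A u∈
... | x , y , x∈A , y∈A , refl = subst (_∈ diffList A) (ℤP.⊖-swap y x) (∈-cartesianProductWith⁺ _⊖_ y∈A x∈A)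

diffList-0 : ∀ {A x} → x ∈ A → ℤ.+ 0 ∈ diffList A
diffList-0 {A} {x} x∈A = subst (_∈ diffList A) (ℤP.n⊖n≡0 x) (∈-cartesianProductWith⁺ _⊖_ x∈A x∈A)

-- A − A is symmetric and contains 0 (for A nonempty), so a duplicate-free
-- list U of positive elements of A − A gives |A − A| ≥ 2|U| + 1.
card-≥ : ∀ {A x} → x ∈ A → {U : List ℤ} → Unique U → All (λ u → ℤ.+ 0 ℤ.< u) U →
         All (_∈ diffList A) U → suc (length U + length U) ≤ card- A
card-≥ {A} x∈A {U} uU U>0 U⊆A-A = begin
  suc (length U + length U)          ≡⟨ cong (λ n → suc (length U + n)) (length-map ℤ.-_ U) ⟨
  suc (length U + length (map ℤ.-_ U)) ≡⟨ cong suc (length-++ U) ⟨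
  length V                           ≤⟨ unique-length-≤ uV V⊆A-A ⟩
  card- A                            ∎
  where
  open ≤-Reasoning
  V : List ℤ
  V = ℤ.+ 0 ∷ (U ++ map ℤ.-_ U)
  -U<0 : All (λ u → ℤ.- u ℤ.< ℤ.+ 0) U
  -U<0 = All.map ℤP.neg-mono-< U>0
  positive∉negated : ∀ {v} → v ∈ U × v ∈ map ℤ.-_ U → ⊥
  positive∉negated (v∈U , v∈-U) with ∈-map⁻ ℤ.-_ v∈-U
  ... | w , w∈U , refl = ℤP.<-asym (All.lookup U>0 v∈U) (All.lookup -U<0 w∈U)
  uV : Unique V
  uV = AllP.++⁺ (All.map ℤP.<⇒≢ U>0) (AllP.map⁺ (All.map (λ -u<0 0≡-u → ℤP.<⇒≢ -u<0 (sym 0≡-u)) -U<0))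
       ∷ UniqueP.++⁺ uU (UniqueP.map⁺ ℤP.neg-injective uU) positive∉negated
  V⊆A-A : ∀ {z} → z ∈ V → z ∈ deduplicate ℤP._≟_ (diffList A)
  V⊆A-A (here refl) = ∈-deduplicate⁺ ℤP._≟_ (diffList-0 x∈A)
  V⊆A-A (there z∈) with ∈-++⁻ U z∈
  ... | inj₁ z∈U = ∈-deduplicate⁺ ℤP._≟_ (All.lookup U⊆A-A z∈U)
  ... | inj₂ z∈-U with ∈-map⁻ ℤ.-_ z∈-U
  ... | w , w∈U , refl = ∈-deduplicate⁺ ℤP._≟_ (diffList-neg A (All.lookup U⊆A-A w∈U))

posDiff-bound : ∀ {A x} → x ∈ A → suc (cardPosDiff A + cardPosDiff A) ≤ card- A
posDiff-bound {A} x∈A = card-≥ x∈A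
  (UniqueP.filter⁺ isPositive? (UniqueDecP.deduplicate-! ℤP._≟_ (diffList A)))
  (All.tabulate (λ u∈ → proj₂ (positiveDiff u∈)))
  (All.tabulate (λ u∈ → ∈-deduplicate⁻ ℤP._≟_ (diffList A) (proj₁ (positiveDiff u∈))))
  where
  isPositive? : (d : ℤ) → Dec (ℤ.+ 0 ℤ.< d)
  isPositive? d = ℤ.+ 0 ℤP.<? d
  distinctDiffs : List ℤ
  distinctDiffs = deduplicate ℤP._≟_ (diffList A)
  positiveDiff : ∀ {u} → u ∈ filter isPositive? distinctDiffs → u ∈ distinctDiffs × ℤ.+ 0 ℤ.< u
  positiveDiff = ∈-filter⁻ isPositive? {xs = distinctDiffs}

record IncreasingEnumeration (A : List ℕ) (n : ℕ) : Set where
  field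
    element    : Fin n → ℕ
    increasing : ∀ {i j} → i Fin.< j → element i < element j
    element∈A  : ∀ i → element i ∈ A
    covers     : ∀ {z} → z ∈ A → ∃ λ i → z ≡ element i

enumerate : ∀ A → Unique A → IncreasingEnumeration A (length (sort A))
enumerate A uA = record
  { element    = lookup (sort A)
  ; increasing = lookup-increasing <-trans sortedStrictly
  ; element∈A  = λ i → ∈-resp-↭ (sort-↭ A) (∈-lookup i)
  ; covers     = λ z∈A → let z∈sorted = ∈-resp-↭ (↭-sym (sort-↭ A)) z∈A in index z∈sorted , lookup-index z∈sorted
  }
  where
  strictly : ∀ {xs} → Linked _≤_ xs → Unique xs → Linked _<_ xs
  strictly [] _ = []
  strictly [-] _ = [-]
  strictly (x≤y ∷ xs↗) ((x≢y ∷ _) ∷ uxs) = ≤∧≢⇒< x≤y x≢y ∷ strictly xs↗ uxs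
  sortedStrictly : Linked _<_ (sort A)
  sortedStrictly = strictly (sort-↗ A)
    (PermutationSetoidP.Unique-resp-↭ (setoid ℕ) (↭⇒↭ₛ (↭-sym (sort-↭ A))) uA)

module SixElements {A : List ℕ} (E : IncreasingEnumeration A 6) where
  open IncreasingEnumeration E
  open IncreasingSix element increasing public
  open Counting ℕ._≟_ using (nub; distinct; ∈-nub⁺; ∈-nub⁻; nub-unique)

  -- Every element of A + A is one of the sums aᵢ + aⱼ with i ≤ j.
  card+≤distinctSums : card+ A ≤ distinct (map sumOf SumPairs)
  card+≤distinctSums = unique-length-≤ (UniqueDecP.deduplicate-! _≟_ (sumList A)) sum∈
    where
    sum∈ : ∀ {z} → z ∈ deduplicate _≟_ (sumList A) → z ∈ nub (map sumOf SumPairs)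
    sum∈ z∈ with ∈-cartesianProductWith⁻ _+_ A A (∈-deduplicate⁻ _≟_ (sumList A) z∈)
    ... | u , v , u∈A , v∈A , refl with covers u∈A | covers v∈A
    ... | i , refl | j , refl = ∈-nub⁺ (map sumOf SumPairs)
      (subst (_∈ map sumOf SumPairs) (sumOf-order i j) (∈-map⁺ sumOf (order∈SumPairs i j)))

  -- The distinct differences aⱼ − aᵢ (i < j) are positive elements of A − A.
  distinctDiffs-bound : suc (distinct (map diffOf DiffPairs) + distinct (map diffOf DiffPairs)) ≤ card- A
  distinctDiffs-bound = subst (λ n → suc (n + n) ≤ card- A) (length-map ℤ.+_ (nub (map diffOf DiffPairs)))
    (card-≥ (element∈A Fin.zero) (UniqueP.map⁺ ℤP.+-injective (nub-unique (map diffOf DiffPairs)))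
      (AllP.map⁺ (All.tabulate (λ w∈ → positive (fromPair w∈))))
      (AllP.map⁺ (All.tabulate (λ w∈ → inDiffList (fromPair w∈)))))
    where
    fromPair : ∀ {w} → w ∈ nub (map diffOf DiffPairs) → ∃ λ P → P ∈ DiffPairs × w ≡ diffOf P
    fromPair {w} w∈ with ∈-map⁻ diffOf (∈-nub⁻ (map diffOf DiffPairs) w∈)
    ... | P , P∈ , refl = P , P∈ , refl
    positive : ∀ {w} → (∃ λ P → P ∈ DiffPairs × w ≡ diffOf P) → ℤ.+ 0 ℤ.< ℤ.+ w
    positive (P , P∈ , refl) = ℤ.+<+ (m<n⇒0<n∸m (increasing (All.lookup DiffPairs-increasing P∈)))
    inDiffList : ∀ {w} → (∃ λ P → P ∈ DiffPairs × w ≡ diffOf P) → ℤ.+ w ∈ diffList A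
    inDiffList ((i , j) , P∈ , refl) =
      subst (_∈ diffList A) (ℤP.⊖-≥ (<⇒≤ (increasing (All.lookup DiffPairs-increasing P∈))))
        (∈-cartesianProductWith⁺ _⊖_ (element∈A j) (element∈A i))

lemma4 : (A : List ℕ) → Unique A → length A ≡ 6 → SumDominant A
    → cardPosDiff A ≤ 8
lemma4 A uA len dom = ≮⇒≥ p≥9⇒⊥
  where
  E : IncreasingEnumeration A 6
  E = subst (IncreasingEnumeration A) (trans (↭-length (sort-↭ A)) len) (enumerate A uA)
  open SixElements E
  open Counting ℕ._≟_ using (distinct; distinct≤length)
  open IncreasingEnumeration E using (element∈A)
  dominant : ∀ {n} → n ≤ card- A → suc n ≤ distinct (map sumOf SumPairs)
  dominant n≤card- = ≤-trans (s≤s n≤card-) (≤-trans dom card+≤distinctSums)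
  p≥9⇒⊥ : 8 < cardPosDiff A → ⊥
  p≥9⇒⊥ p≥9 = ≤⇒≯ (distinct≤length (map sumOf SumPairs)) (≤-trans (m≤n+m 22 6) (dominant card-≥27))
    where
    card-≥19 : 19 ≤ card- A
    card-≥19 = ≤-trans (s≤s (+-mono-≤ p≥9 p≥9)) (posDiff-bound (element∈A Fin.zero))
    diffs≥13 : 13 ≤ distinct (map diffOf DiffPairs)
    diffs≥13 = distinctSums≥20⇒distinctDiffs≥13 (dominant card-≥19)
    card-≥27 : 27 ≤ card- A
    card-≥27 = ≤-trans (s≤s (+-mono-≤ diffs≥13 diffs≥13)) distinctDiffs-bound
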